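{- Let $n\ge1$, let $C$ be the cyclic shift on $\mathbb{Z}_2^{2n+1}$, $C(x_0,\dots,x_{2n})=(x_1,\dots,x_{2n},x_0)$, and let $\mathcal{G}_{2n+1}(2n)$ be the set of sequences in $\mathbb{Z}_2^{2n+1}$ with exactly one coordinate equal to $-1$. Then for every $X\in\mathcal{G}_{2n+1}(2n)$, every $k\in\{1,\dots,2n\}$ and every divisor $d<2n+1$ of $2n+1$, we have $X\cdot C^kX\notin F_d(\mathbb{Z}_2^{2n+1})$, where $F_d(\mathbb{Z}_2^{2n+1})$ is the set of elements whose orbit under $\langle C\rangle$ has exactly $d$ elements.
   Context: $\mathbb{Z}_2^{2n+1}$ is the group of $\pm1$ sequences of length $2n+1$ under coordinatewise multiplication. -}

module Defs where

open import Data.Nat using (ℕ; zero; suc; _+_; _*_)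
open import Data.Bool using (Bool; true; false; _xor_)
open import Data.Vec using (Vec; []; _∷_; _∷ʳ_; zipWith; count)
open import Data.List using (List; length)
open import Data.List.Membership.Propositional using (_∈_)
open import Data.List.Relation.Unary.Unique.Propositional using (Unique)
open import Data.Product using (∃; _×_)
open import Function.Bundles using (_⇔_)
open import Relation.Binary.PropositionalEquality using (_≡_)
open import Relation.Nullary.Decidable using (does)

-- ℤ₂ = {±1} encoded as Bool: true ↔ -1, false ↔ +1.
-- Multiplication of ±1 corresponds to xor.
-- An element of ℤ₂^m is a Vec Bool m; coordinate i is x_i.

_·_ : ∀ {m} → Vec Bool m → Vec Bool m → Vec Bool m
_·_ = zipWith _xor_

C : ∀ {m} → Vec Bool m → Vec Bool m
C [] = []
C (x ∷ xs) = xs ∷ʳ x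

C^ : ∀ {m} → ℕ → Vec Bool m → Vec Bool m
C^ zero x = x
C^ (suc k) x = C (C^ k x)

numMinus : ∀ {m} → Vec Bool m → ℕ
numMinus = count (λ b → Data.Bool._≟_ b true)

inG : ∀ {m} → Vec Bool m → Set
inG x = numMinus x ≡ 1

OrbitSize : ∀ {m} → Vec Bool m → ℕ → Set
OrbitSize {m} x d =
  ∃ λ (L : List (Vec Bool m)) →
    Unique L × length L ≡ d × (∀ y → (y ∈ L) ⇔ (∃ λ j → C^ j x ≡ y))

inF : ∀ {m} → ℕ → Vec Bool m → Set
inF d x = OrbitSize x d

-- Say the only -1 of X sits at position P (indices mod 2n+1). Then Y = X · CᵏX has its
-- -1's exactly at P and P - k. If the orbit of Y had fewer than 2n+1 elements, some shift
-- Cᵗ with 0 < t < 2n+1 would fix Y, so t would permute the two positions of the -1's of Y.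
-- Since t ≢ 0 it must swap them, which forces 2t ≡ 0 (mod 2n+1): impossible for an odd modulus.
module Submission where

open import Defs
open import Data.Nat using (ℕ; suc; _+_; _*_; _≤_; _<_)
open import Data.Nat.Divisibility using (_∣_)
open import Data.Bool using (Bool)
open import Data.Vec using (Vec)
open import Relation.Nullary using (¬_)

open import Data.Bool using (true; false; _xor_)
open import Data.Bool.Properties using (¬-not; xor-identityʳ)
open import Data.Empty using (⊥-elim)
open import Data.Fin as Fin using (Fin; toℕ; fromℕ<; inject₁)
open import Data.Fin.Properties using (toℕ<n; toℕ-fromℕ<; toℕ-inject₁; pigeonhole)
open import Data.List as List using (List; _++_)
open import Data.List.Membership.Propositional using (_∈_)
open import Data.List.Properties using (++-assoc; ++-identityʳ)
open import Data.List.Relation.Unary.Any using (index)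
open import Data.List.Relation.Unary.Any.Properties using (lookup-index)
open import Data.Nat using (zero; _∸_; _<?_; s≤s)
open import Data.Nat.Properties
open import Data.Product using (Σ; ∃; _×_; _,_)
open import Data.Vec using ([]; _∷_; _∷ʳ_; lookup; toList; zipWith)
open import Data.Vec.Properties using (toList-∷ʳ; toList-injective; cast-is-id; length-toList; lookup-zipWith)
open import Function.Bundles using (Equivalence)
open import Relation.Binary.PropositionalEquality
open import Relation.Nullary using (yes; no)
open import Relation.Binary.Definitions using (tri<; tri≈; tri>)

private
  variable
    m : ℕ

C^-+ : ∀ a b (x : Vec Bool m) → C^ a (C^ b x) ≡ C^ (a + b) x
C^-+ zero    b x = refl
C^-+ (suc a) b x = cong C (C^-+ a b x)

C^-suc : ∀ a (x : Vec Bool m) → C^ (suc a) x ≡ C^ a (C x)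
C^-suc zero    x = refl
C^-suc (suc a) x = cong C (C^-suc a x)

zipWith-∷ʳ : ∀ (xs ys : Vec Bool m) a b →
             zipWith _xor_ (xs ∷ʳ a) (ys ∷ʳ b) ≡ zipWith _xor_ xs ys ∷ʳ (a xor b)
zipWith-∷ʳ []       []       a b = refl
zipWith-∷ʳ (x ∷ xs) (y ∷ ys) a b = cong ((x xor y) ∷_) (zipWith-∷ʳ xs ys a b)

C-· : ∀ (x y : Vec Bool m) → C (x · y) ≡ C x · C y
C-· []       []       = refl
C-· (a ∷ xs) (b ∷ ys) = sym (zipWith-∷ʳ xs ys a b)

C^-· : ∀ k (x y : Vec Bool m) → C^ k (x · y) ≡ C^ k x · C^ k y
C^-· zero    x y = refl
C^-· (suc k) x y = trans (cong C (C^-· k x y)) (C-· (C^ k x) (C^ k y))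

rotate : List Bool → List Bool
rotate List.[]       = List.[]
rotate (x List.∷ xs) = xs ++ List.[ x ]

rotate^ : ℕ → List Bool → List Bool
rotate^ zero    l = l
rotate^ (suc k) l = rotate^ k (rotate l)

rotate^-++ : ∀ (xs ys : List Bool) → rotate^ (List.length xs) (xs ++ ys) ≡ ys ++ xs
rotate^-++ List.[]       ys = sym (++-identityʳ ys)
rotate^-++ (x List.∷ xs) ys = begin
  rotate^ (List.length xs) ((xs ++ ys) ++ List.[ x ]) ≡⟨ cong (rotate^ (List.length xs)) (++-assoc xs ys List.[ x ]) ⟩
  rotate^ (List.length xs) (xs ++ (ys ++ List.[ x ])) ≡⟨ rotate^-++ xs (ys ++ List.[ x ]) ⟩
  (ys ++ List.[ x ]) ++ xs                             ≡⟨ ++-assoc ys List.[ x ] xs ⟩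
  ys ++ x List.∷ xs                                    ∎
  where open ≡-Reasoning

toList-C^ : ∀ k (x : Vec Bool m) → toList (C^ k x) ≡ rotate^ k (toList x)
toList-C^ zero    x = refl
toList-C^ (suc k) x = begin
  toList (C^ (suc k) x)       ≡⟨ cong toList (C^-suc k x) ⟩
  toList (C^ k (C x))         ≡⟨ toList-C^ k (C x) ⟩
  rotate^ k (toList (C x))    ≡⟨ cong (rotate^ k) (toList-C x) ⟩
  rotate^ k (rotate (toList x)) ∎
  where
  open ≡-Reasoning
  toList-C : ∀ {m} (x : Vec Bool m) → toList (C x) ≡ rotate (toList x)
  toList-C []       = refl
  toList-C (a ∷ xs) = toList-∷ʳ a xs

C^-length : ∀ (x : Vec Bool m) → C^ m x ≡ x
C^-length {m} x = trans (sym (cast-is-id refl (C^ m x))) (toList-injective refl (C^ m x) x (begin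
  toList (C^ m x)                                ≡⟨ toList-C^ m x ⟩
  rotate^ m (toList x)                           ≡⟨ cong (λ k → rotate^ k (toList x)) (sym (length-toList x)) ⟩
  rotate^ (List.length (toList x)) (toList x)    ≡⟨ cong (rotate^ (List.length (toList x))) (sym (++-identityʳ (toList x))) ⟩
  rotate^ (List.length (toList x)) (toList x ++ List.[]) ≡⟨ rotate^-++ (toList x) List.[] ⟩
  toList x                                       ∎))
  where open ≡-Reasoning

C^-cancelˡ : ∀ i {x y : Vec Bool m} → i ≤ m → C^ i x ≡ C^ i y → x ≡ y
C^-cancelˡ {m} i {x} {y} i≤m eq = begin
  x                  ≡⟨ sym (C^-length x) ⟩
  C^ m x             ≡⟨ cong (λ j → C^ j x) (sym (m∸n+n≡m i≤m)) ⟩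
  C^ (m ∸ i + i) x   ≡⟨ sym (C^-+ (m ∸ i) i x) ⟩
  C^ (m ∸ i) (C^ i x) ≡⟨ cong (C^ (m ∸ i)) eq ⟩
  C^ (m ∸ i) (C^ i y) ≡⟨ C^-+ (m ∸ i) i y ⟩
  C^ (m ∸ i + i) y   ≡⟨ cong (λ j → C^ j y) (m∸n+n≡m i≤m) ⟩
  C^ m y             ≡⟨ C^-length y ⟩
  y                  ∎
  where open ≡-Reasoning

C^-repeat⇒period : ∀ {i j} (y : Vec Bool m) → i < j → j ≤ m → C^ i y ≡ C^ j y → C^ (j ∸ i) y ≡ y
C^-repeat⇒period {i = i} {j} y i<j j≤m eq = C^-cancelˡ i (≤-trans (<⇒≤ i<j) j≤m) (begin
  C^ i (C^ (j ∸ i) y) ≡⟨ C^-+ i (j ∸ i) y ⟩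
  C^ (i + (j ∸ i)) y  ≡⟨ cong (λ l → C^ l y) (m+[n∸m]≡n (<⇒≤ i<j)) ⟩
  C^ j y              ≡⟨ sym eq ⟩
  C^ i y              ∎)
  where open ≡-Reasoning

-- A list of d < m elements cannot hold C⁰y, …, Cᵐ⁻¹y at distinct positions.
orbitSize<⇒period : ∀ {d} (y : Vec Bool m) → OrbitSize y d → d < m →
                    ∃ λ t → 0 < t × t < m × C^ t y ≡ y
orbitSize<⇒period {m} y (L , _ , |L|≡d , orbit) d<m =
  let i , j , i<j , same = pigeonhole (subst (_< m) (sym |L|≡d) d<m) position
      j<m = toℕ<n j
  in toℕ j ∸ toℕ i , m<n⇒0<n∸m i<j , ≤-<-trans (m∸n≤m (toℕ j) (toℕ i)) j<m
   , C^-repeat⇒period y i<j (<⇒≤ j<m) (begin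
       C^ (toℕ i) y                  ≡⟨ lookup-index (member i) ⟩
       List.lookup L (position i)    ≡⟨ cong (List.lookup L) same ⟩
       List.lookup L (position j)    ≡⟨ sym (lookup-index (member j)) ⟩
       C^ (toℕ j) y                  ∎)
  where
  open ≡-Reasoning
  member : ∀ (j : Fin m) → C^ (toℕ j) y ∈ L
  member j = Equivalence.from (orbit _) (toℕ j , refl)
  position : Fin m → Fin (List.length L)
  position j = index (member j)

-- coord x i is the coordinate of x at index i taken modulo the length of x.
coord : Vec Bool (suc m) → ℕ → Bool
coord x i = lookup (C^ i x) Fin.zero

coord-· : ∀ (x y : Vec Bool (suc m)) i → coord (x · y) i ≡ coord x i xor coord y i
coord-· x y i = trans (cong (λ v → lookup v Fin.zero) (C^-· i x y)) (lookup-zipWith _xor_ Fin.zero (C^ i x) (C^ i y))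

coord-C^ : ∀ (x : Vec Bool (suc m)) i k → coord (C^ k x) i ≡ coord x (i + k)
coord-C^ x i k = cong (λ v → lookup v Fin.zero) (C^-+ i k x)

coord-periodic : ∀ (x : Vec Bool (suc m)) i → coord x (i + suc m) ≡ coord x i
coord-periodic x i = trans (sym (coord-C^ x i _)) (cong (λ v → coord v i) (C^-length x))

lookup-∷ʳ-inject₁ : ∀ (xs : Vec Bool m) a (i : Fin m) → lookup (xs ∷ʳ a) (inject₁ i) ≡ lookup xs i
lookup-∷ʳ-inject₁ (x ∷ xs) a Fin.zero    = refl
lookup-∷ʳ-inject₁ (x ∷ xs) a (Fin.suc i) = lookup-∷ʳ-inject₁ xs a i

coord-toℕ : ∀ (x : Vec Bool (suc m)) (i : Fin (suc m)) → coord x (toℕ i) ≡ lookup x i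
coord-toℕ x i = coord-at x i refl
  where
  coord-at : ∀ {m} (x : Vec Bool (suc m)) (i : Fin (suc m)) {j} → toℕ i ≡ j → coord x j ≡ lookup x i
  coord-at (a ∷ xs) Fin.zero    refl = refl
  coord-at (a ∷ xs) (Fin.suc i) {suc j} 1+i≡1+j = begin
    coord (a ∷ xs) (suc j)          ≡⟨ cong (λ v → lookup v Fin.zero) (C^-suc j (a ∷ xs)) ⟩
    coord (xs ∷ʳ a) j               ≡⟨ coord-at (xs ∷ʳ a) (inject₁ i) (trans (toℕ-inject₁ i) (suc-injective 1+i≡1+j)) ⟩
    lookup (xs ∷ʳ a) (inject₁ i)    ≡⟨ lookup-∷ʳ-inject₁ xs a i ⟩
    lookup xs i                     ∎
    where open ≡-Reasoning

numMinus≡0⇒lookup≡false : ∀ (x : Vec Bool m) → numMinus x ≡ 0 → ∀ i → lookup x i ≡ false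
numMinus≡0⇒lookup≡false (false ∷ xs) none Fin.zero    = refl
numMinus≡0⇒lookup≡false (false ∷ xs) none (Fin.suc i) = numMinus≡0⇒lookup≡false xs none i

numMinus≡1⇒unique-true : ∀ (x : Vec Bool m) → numMinus x ≡ 1 →
                         Σ (Fin m) λ p → lookup x p ≡ true × (∀ i → lookup x i ≡ true → i ≡ p)
numMinus≡1⇒unique-true (true ∷ xs) one = Fin.zero , refl , unique
  where
  unique : ∀ i → lookup (true ∷ xs) i ≡ true → i ≡ Fin.zero
  unique Fin.zero    _     = refl
  unique (Fin.suc i) xsᵢ≡true with trans (sym xsᵢ≡true) (numMinus≡0⇒lookup≡false xs (suc-injective one) i)
  ... | ()
numMinus≡1⇒unique-true (false ∷ xs) one =
  let p , xsₚ≡true , unique = numMinus≡1⇒unique-true xs one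
  in Fin.suc p , xsₚ≡true , λ { Fin.zero () ; (Fin.suc i) xsᵢ≡true → cong Fin.suc (unique i xsᵢ≡true) }

inG⇒single-spike : ∀ (x : Vec Bool (suc m)) → inG x →
                   ∃ λ P → P < suc m × coord x P ≡ true × (∀ i → i < suc m → coord x i ≡ true → i ≡ P)
inG⇒single-spike x one =
  let p , xₚ≡true , unique = numMinus≡1⇒unique-true x one
  in toℕ p , toℕ<n p , trans (coord-toℕ x p) xₚ≡true
   , λ i i<m xᵢ≡true → begin
       i                     ≡⟨ sym (toℕ-fromℕ< i<m) ⟩
       toℕ (fromℕ< i<m)      ≡⟨ cong toℕ (unique _ (begin
                                  lookup x (fromℕ< i<m)        ≡⟨ sym (coord-toℕ x (fromℕ< i<m)) ⟩
                                  coord x (toℕ (fromℕ< i<m))   ≡⟨ cong (coord x) (toℕ-fromℕ< i<m) ⟩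
                                  coord x i                    ≡⟨ xᵢ≡true ⟩
                                  true                         ∎)) ⟩
       toℕ p                 ∎
  where open ≡-Reasoning

module SingleSpike {M : ℕ} (f : ℕ → Bool) (f-periodic : ∀ i → f (i + M) ≡ f i)
                   {P : ℕ} (P<M : P < M) (f-P : f P ≡ true)
                   (f-unique : ∀ i → i < M → f i ≡ true → i ≡ P) where

  spike-isolated : ∀ {s} → 0 < s → s < M → f (P + s) ≢ true
  spike-isolated {s} 0<s s<M fₚ₊ₛ with P + s <? M
  ... | yes P+s<M = <⇒≢ (m<m+n P 0<s) (sym (f-unique (P + s) P+s<M fₚ₊ₛ))
  ... | no  P+s≮M = <⇒≢ s<M (+-cancelˡ-≡ P s M (trans (sym r+M≡P+s) (cong (_+ M) r≡P)))
    where
    r = P + s ∸ M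
    r+M≡P+s : r + M ≡ P + s
    r+M≡P+s = m∸n+n≡m (≮⇒≥ P+s≮M)
    r<M : r < M
    r<M = +-cancelʳ-< M r M (subst (_< M + M) (sym r+M≡P+s) (+-mono-< P<M s<M))
    r≡P : r ≡ P
    r≡P = f-unique r r<M (trans (sym (f-periodic r)) (trans (cong f r+M≡P+s) fₚ₊ₛ))

  spike-returns-at-M : ∀ {s} → 0 < s → s < M + M → f (P + s) ≡ true → s ≡ M
  spike-returns-at-M {s} 0<s s<2M fₚ₊ₛ with <-cmp s M
  ... | tri< s<M _ _ = ⊥-elim (spike-isolated 0<s s<M fₚ₊ₛ)
  ... | tri≈ _ s≡M _ = s≡M
  ... | tri> _ _ M<s = ⊥-elim (spike-isolated (m<n⇒0<n∸m M<s) s∸M<M (begin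
    f (P + (s ∸ M))        ≡⟨ sym (f-periodic (P + (s ∸ M))) ⟩
    f (P + (s ∸ M) + M)    ≡⟨ cong f (+-assoc P (s ∸ M) M) ⟩
    f (P + ((s ∸ M) + M))  ≡⟨ cong (λ j → f (P + j)) s∸M+M≡s ⟩
    f (P + s)              ≡⟨ fₚ₊ₛ ⟩
    true                   ∎))
    where
    open ≡-Reasoning
    s∸M+M≡s : s ∸ M + M ≡ s
    s∸M+M≡s = m∸n+n≡m (<⇒≤ M<s)
    s∸M<M : s ∸ M < M
    s∸M<M = +-cancelʳ-< M (s ∸ M) M (subst (_< M + M) (sym s∸M+M≡s) s<2M)

  -- The difference sequence has its spikes at P and P - k; a period t must swap them.
  period-of-difference : ∀ {k t} → 0 < k → k < M → 0 < t → t < M →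
                         (∀ a → f (a + t) xor f (a + t + k) ≡ f a xor f (a + k)) →
                         t + t ≡ M
  period-of-difference {k} {t} 0<k k<M 0<t t<M period =
    spike-returns-at-M (<-≤-trans 0<t (m≤m+n t t)) (+-mono-< t<M t<M) (begin
      f (P + (t + t))                  ≡⟨ cong f (sym (+-assoc P t t)) ⟩
      f (P + t + t)                    ≡⟨ sym (xor-identityʳ (f (P + t + t))) ⟩
      f (P + t + t) xor false          ≡⟨ cong (f (P + t + t) xor_) (sym fₚ₊₂ₜ₊ₖ) ⟩
      f (P + t + t) xor f (P + t + t + k) ≡⟨ period (P + t) ⟩
      f (P + t) xor f (P + t + k)      ≡⟨ cong₂ _xor_ fₚ₊ₜ fₚ₊ₜ₊ₖ ⟩
      true                             ∎)
    where
    open ≡-Reasoning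
    fₚ₊ₖ : f (P + k) ≡ false
    fₚ₊ₖ = ¬-not (spike-isolated 0<k k<M)
    fₚ₊ₜ : f (P + t) ≡ false
    fₚ₊ₜ = ¬-not (spike-isolated 0<t t<M)
    fₚ₊ₜ₊ₖ : f (P + t + k) ≡ true
    fₚ₊ₜ₊ₖ = begin
      f (P + t + k)                ≡⟨ cong (_xor f (P + t + k)) (sym fₚ₊ₜ) ⟩
      f (P + t) xor f (P + t + k)  ≡⟨ period P ⟩
      f P xor f (P + k)            ≡⟨ cong₂ _xor_ f-P fₚ₊ₖ ⟩
      true                         ∎
    t+k≡M : t + k ≡ M
    t+k≡M = spike-returns-at-M (<-≤-trans 0<t (m≤m+n t k)) (+-mono-< t<M k<M)
              (trans (cong f (sym (+-assoc P t k))) fₚ₊ₜ₊ₖ)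
    fₚ₊₂ₜ₊ₖ : f (P + t + t + k) ≡ false
    fₚ₊₂ₜ₊ₖ = begin
      f (P + t + t + k)    ≡⟨ cong f (+-assoc (P + t) t k) ⟩
      f (P + t + (t + k))  ≡⟨ cong (λ j → f (P + t + j)) t+k≡M ⟩
      f (P + t + M)        ≡⟨ f-periodic (P + t) ⟩
      f (P + t)            ≡⟨ fₚ₊ₜ ⟩
      false                ∎

coord-difference : ∀ (x : Vec Bool (suc m)) k i → coord (x · C^ k x) i ≡ coord x i xor coord x (i + k)
coord-difference x k i = trans (coord-· x (C^ k x) i) (cong (coord x i xor_) (coord-C^ x i k))

fixed-difference⇒period : ∀ (x : Vec Bool (suc m)) k t → C^ t (x · C^ k x) ≡ x · C^ k x →
                          ∀ a → coord x (a + t) xor coord x (a + t + k) ≡ coord x a xor coord x (a + k)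
fixed-difference⇒period x k t fixed a = begin
  coord x (a + t) xor coord x (a + t + k)  ≡⟨ sym (coord-difference x k (a + t)) ⟩
  coord (x · C^ k x) (a + t)               ≡⟨ sym (coord-C^ (x · C^ k x) a t) ⟩
  coord (C^ t (x · C^ k x)) a              ≡⟨ cong (λ v → coord v a) fixed ⟩
  coord (x · C^ k x) a                     ≡⟨ coord-difference x k a ⟩
  coord x a xor coord x (a + k)            ∎
  where open ≡-Reasoning

mainTheorem13 : ∀ (n : ℕ) → 1 ≤ n →
    ∀ (X : Vec Bool (suc (2 * n))) → inG X →
    ∀ (k : ℕ) → 1 ≤ k → k ≤ 2 * n →
    ∀ (d : ℕ) → d ∣ suc (2 * n) → d < suc (2 * n) →
    ¬ inF d (X · C^ k X)
mainTheorem13 n _ X X∈G k 1≤k k≤2n d _ d<2n+1 Y∈F =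
  let t , 0<t , t<2n+1 , CᵗY≡Y = orbitSize<⇒period (X · C^ k X) Y∈F d<2n+1
      P , P<2n+1 , X-P , X-unique = inG⇒single-spike X X∈G
      open SingleSpike (coord X) (coord-periodic X) P<2n+1 X-P X-unique
      t+t≡2n+1 = period-of-difference 1≤k (s≤s k≤2n) 0<t t<2n+1 (fixed-difference⇒period X k t CᵗY≡Y)
  in even≢odd t n (trans (cong (t +_) (+-identityʳ t)) t+t≡2n+1)
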